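{- Let $f \in \mathrm{Inc}^q(P)$. Then, $S(\textnormal{swap}(f)) = \kappa(S^{ -1}(f))$.
   Context: $P$ is a finite self-dual poset with fixed order-reversing involution $\kappa$. $\mathrm{Inc}^q(P)$ is the set of increasing labelings $f:P\to[q]$ ($f(x)<f(y)$ whenever $x<y$). Promotion $\mathrm{Pro}$: replace labels $1$ by empty boxes; for $i=2,\dots,q$ slide boxes upward (a box at $x$ becomes $i$ if some $y\gtrdot x$ is labeled $i$, and an element labeled $i$ covering a box becomes a box); replace boxes by $q+1$ and subtract $1$ from all labels. The sliding subposet $S(g)$ is the induced subposet of elements that are labeled by a box at some point while computing $\mathrm{Pro}(g)$; $S^{ -1}(f)$ is the sliding subposet of $\mathrm{Pro}^{ -1}(f)$. $\mathrm{swap}(f)(x)=q+1-f(\kappa(x))$. -}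

module Defs where

open import Level using (0ℓ)
open import Data.Nat as ℕ using (ℕ; zero; suc; _∸_; _+_)
open import Data.Fin using (Fin)
open import Data.Fin.Properties using (any?; all?)
open import Data.Maybe using (Maybe; just; nothing)
open import Data.Maybe.Properties using () renaming (≡-dec to ≡-decM)
open import Data.Product using (_×_; _,_; ∃; ∃-syntax)
open import Data.Product.Properties using ()
open import Relation.Nullary using (¬_; Dec; yes; no; does)
open import Relation.Nullary.Decidable using (_×-dec_; ¬?)
open import Relation.Binary using (Rel; Decidable; IsPartialOrder)
open import Relation.Binary.PropositionalEquality using (_≡_; _≢_)
open import Relation.Unary using (Pred)
open import Data.Bool using (if_then_else_)

record FinPoset : Set₁ where
  field
    size           : ℕ
    _≤ₚ_           : Rel (Fin size) 0ℓ
    isPartialOrder : IsPartialOrder _≡_ _≤ₚ_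
    _≤ₚ?_          : Decidable _≤ₚ_

  Elt : Set
  Elt = Fin size

  _<ₚ_ : Rel Elt 0ℓ
  x <ₚ y = x ≤ₚ y × x ≢ y

  _<ₚ?_ : Decidable _<ₚ_
  x <ₚ? y = (x ≤ₚ? y) ×-dec ¬? (x Data.Fin.≟ y)

  _⋖_ : Rel Elt 0ℓ
  x ⋖ y = x <ₚ y × (∀ z → ¬ (x <ₚ z × z <ₚ y))

  _⋖?_ : Decidable _⋖_
  x ⋖? y = (x <ₚ? y) ×-dec all? (λ z → ¬? ((x <ₚ? z) ×-dec (z <ₚ? y)))

record SelfDual (P : FinPoset) : Set where
  open FinPoset P
  field
    κ            : Elt → Elt
    κ-involutive : ∀ x → κ (κ x) ≡ x
    κ-reversing  : ∀ {x y} → x ≤ₚ y → κ y ≤ₚ κ x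

module _ (P : FinPoset) where
  open FinPoset P

  Labeling : Set
  Labeling = Elt → ℕ

  IsInc : ℕ → Labeling → Set
  IsInc q f = (∀ x → 1 ℕ.≤ f x × f x ℕ.≤ q) × (∀ {x y} → x <ₚ y → f x ℕ.< f y)

  -- Intermediate states of promotion: nothing = empty box, just i = label i.
  State : Set
  State = Elt → Maybe ℕ

  -- One sliding step for label i, with respect to a relation C
  -- (C x y means "y is the neighbour of x in the sliding direction").
  slideStep : (C : Rel Elt 0ℓ) → Decidable C → ℕ → State → State
  slideStep C C? i st x with st x ≡-decM? nothing
    where
      _≡-decM?_ : (a b : Maybe ℕ) → Dec (a ≡ b)
      _≡-decM?_ = ≡-decM ℕ._≟_
  ... | yes _ = if does (any? (λ y → C? x y ×-dec ≡-decM ℕ._≟_ (st y) (just i)))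
                  then just i else nothing
  ... | no _  = if does (≡-decM ℕ._≟_ (st x) (just i))
                  then (if does (any? (λ y → C? y x ×-dec ≡-decM ℕ._≟_ (st y) nothing))
                          then nothing else st x)
                  else st x

  -- proState q f k : state after replacing 1's by boxes (k = 0) and then
  -- performing the sliding steps for i = 2, …, k+1.
  proState : ℕ → Labeling → ℕ → State
  proState q f zero    x = if does (f x ℕ.≟ 1) then nothing else just (f x)
  proState q f (suc k) = slideStep _⋖_ _⋖?_ (suc (suc k)) (proState q f k)

  -- boxes become q+1, then subtract 1 from every label
  finishPro : ℕ → State → Labeling
  finishPro q st x with st x
  ... | nothing = q
  ... | just i  = i ∸ 1

  Pro : ℕ → Labeling → Labeling
  Pro q f = finishPro q (proState q f (q ∸ 1))

  -- Sliding subposet S(g): elements that are a box at some point while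
  -- computing Pro(g) (as a subset of P; the subposet is the induced one).
  S : ℕ → Labeling → Pred Elt 0ℓ
  S q g x = ∃[ k ] (k ℕ.≤ q ∸ 1 × proState q g k x ≡ nothing)

  -- Inverse promotion Pro⁻¹ (the reverse procedure): replace labels q by
  -- boxes; for i = q-1, …, 1 slide boxes downward; replace boxes by 0 and
  -- add 1 to all labels.

  _⋗_ : Rel Elt 0ℓ
  x ⋗ y = y ⋖ x

  proInvState : ℕ → Labeling → ℕ → State
  proInvState q f zero    x = if does (f x ℕ.≟ q) then nothing else just (f x)
  proInvState q f (suc k) = slideStep _⋗_ (λ x y → y ⋖? x) (q ∸ suc k) (proInvState q f k)

  finishProInv : State → Labeling
  finishProInv st x with st x
  ... | nothing = 1
  ... | just i  = suc i

  Pro⁻¹ : ℕ → Labeling → Labeling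
  Pro⁻¹ q f = finishProInv (proInvState q f (q ∸ 1))

  S⁻¹ : ℕ → Labeling → Pred Elt 0ℓ
  S⁻¹ q f = S q (Pro⁻¹ q f)

swap : {P : FinPoset} → SelfDual P → ℕ → Labeling P → Labeling P
swap sd q f x = suc q ∸ f (SelfDual.κ sd x)

image : {A : Set} → (A → A) → Pred A 0ℓ → Pred A 0ℓ
image g U x = ∃[ a ] (U a × g a ≡ x)

-- Computing Pro(swap f) is the computation of Pro⁻¹(f) seen through κ: κ turns upward slides
-- into downward ones, and v ↦ q + 1 − v turns the slide of label k + 1 into the slide of q − k,
-- so the k-th states of the two computations agree up to κ and complementing labels.
-- Computing Pro(Pro⁻¹ f) retraces the computation of Pro⁻¹ f backwards, with labels shifted by
-- one: an upward slide of label j undoes a downward slide of j as soon as the state is increasing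
-- when boxes are read as j + ½, and this invariant holds at every stage of Pro⁻¹ f. So S(swap f)
-- and κ(S⁻¹ f) are both the κ-image of the elements that are boxes at some stage of Pro⁻¹ f.
module Submission where

open import Level using (0ℓ)
open import Defs
open import Data.Nat as ℕ using (ℕ; zero; suc; _∸_; _+_; _<_; _≤_)
open import Data.Nat.Properties
open import Data.Fin.Properties using (any?)
open import Data.Maybe using (Maybe; just; nothing; map)
open import Data.Maybe.Properties using (just-injective; map-nothing) renaming (≡-dec to ≡-decM)
open import Data.Product using (_×_; _,_; ∃-syntax; proj₁; proj₂)
open import Data.Empty using (⊥; ⊥-elim)
open import Relation.Nullary using (¬_; Dec; yes; no; does)
open import Relation.Nullary.Decidable using (_×-dec_; dec-true; dec-false)
open import Relation.Binary using (Rel; Decidable)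
open import Relation.Binary.PropositionalEquality
open import Relation.Unary using (Pred; _≐_)
open import Data.Bool using (if_then_else_)
open import Function using (_∘_; id)

if-dec-true : ∀ {A B : Set} (d : Dec A) {a b : B} → A → (if does d then a else b) ≡ a
if-dec-true d p rewrite dec-true d p = refl

if-dec-false : ∀ {A B : Set} (d : Dec A) {a b : B} → ¬ A → (if does d then a else b) ≡ b
if-dec-false d ¬p rewrite dec-false d ¬p = refl

just≢nothing : ∀ {A : Set} {a : A} → just a ≢ nothing
just≢nothing ()

map-nothing⁻¹ : ∀ {A B : Set} (h : A → B) {ma : Maybe A} → map h ma ≡ nothing → ma ≡ nothing
map-nothing⁻¹ h {nothing} _ = refl

module Sliding (P : FinPoset) where
  open FinPoset P

  module _ (C : Rel Elt 0ℓ) (i : ℕ) (st : State P) (x : Elt) where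

    Fills : Set
    Fills = ∃[ y ] (C x y × st y ≡ just i)

    Vacates : Set
    Vacates = ∃[ y ] (C y x × st y ≡ nothing)

    data SlideCase : Set where
      fill       : st x ≡ nothing → Fills → SlideCase
      stay-box   : st x ≡ nothing → ¬ Fills → SlideCase
      vacate     : st x ≡ just i → Vacates → SlideCase
      stay-label : st x ≡ just i → ¬ Vacates → SlideCase
      untouched  : ∀ {v} → st x ≡ just v → v ≢ i → SlideCase

    after : SlideCase → Maybe ℕ
    after (fill _ _)          = just i
    after (stay-box _ _)      = nothing
    after (vacate _ _)        = nothing
    after (stay-label _ _)    = just i
    after (untouched {v} _ _) = just v

  module _ {C : Rel Elt 0ℓ} (C? : Decidable C) (i : ℕ) (st : State P) (x : Elt) where

    private
      _≟ₘ_ : (a b : Maybe ℕ) → Dec (a ≡ b)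
      _≟ₘ_ = ≡-decM ℕ._≟_

      fills? : Dec (Fills C i st x)
      fills? = any? (λ y → C? x y ×-dec (st y ≟ₘ just i))

      vacates? : Dec (Vacates C i st x)
      vacates? = any? (λ y → C? y x ×-dec (st y ≟ₘ nothing))

    slideCase : SlideCase C i st x
    slideCase with st x in e
    ... | nothing with fills?
    ...   | yes p = fill e p
    ...   | no ¬p = stay-box e ¬p
    slideCase | just v with v ℕ.≟ i
    ...   | no v≢i = untouched e v≢i
    ...   | yes refl with vacates?
    ...     | yes p = vacate e p
    ...     | no ¬p = stay-label e ¬p

    slideStep-case : (c : SlideCase C i st x) → slideStep P C C? i st x ≡ after C i st x c
    slideStep-case c with st x ≟ₘ nothing
    slideStep-case (fill _ p)        | yes _  = if-dec-true fills? p
    slideStep-case (stay-box _ ¬p)   | yes _  = if-dec-false fills? ¬p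
    slideStep-case (vacate e _)      | yes b  = ⊥-elim (just≢nothing (trans (sym e) b))
    slideStep-case (stay-label e _)  | yes b  = ⊥-elim (just≢nothing (trans (sym e) b))
    slideStep-case (untouched e _)   | yes b  = ⊥-elim (just≢nothing (trans (sym e) b))
    slideStep-case (fill e _)        | no ¬b = ⊥-elim (¬b e)
    slideStep-case (stay-box e _)    | no ¬b = ⊥-elim (¬b e)
    slideStep-case (vacate e p)      | no _  =
      trans (if-dec-true (st x ≟ₘ just i) e) (if-dec-true vacates? p)
    slideStep-case (stay-label e ¬p) | no _  =
      trans (if-dec-true (st x ≟ₘ just i) e) (trans (if-dec-false vacates? ¬p) e)
    slideStep-case (untouched e v≢i) | no _  =
      trans (if-dec-false (st x ≟ₘ just i) (v≢i ∘ just-injective ∘ trans (sym e))) e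

  module _ {C C′ : Rel Elt 0ℓ} {σ τ : Elt → Elt} (σ∘τ : ∀ y → σ (τ y) ≡ y)
           (C′⇒C : ∀ {x y} → C′ x y → C (σ x) (σ y))
           (C⇒C′ : ∀ {x y} → C (σ x) (σ y) → C′ x y)
           {h : ℕ → ℕ} {i i′ : ℕ} (h-i : h i ≡ i′) {st st′ : State P}
           (st′≡ : ∀ y → st′ y ≡ map h (st (σ y)))
           (h-injective-at-i : ∀ {y v} → st y ≡ just v → h v ≡ i′ → v ≡ i) where

    private
      forth : ∀ {y a} → st (σ y) ≡ a → st′ y ≡ map h a
      forth {y} e = trans (st′≡ y) (cong (map h) e)

      forthτ : ∀ {y a} → st y ≡ a → st′ (τ y) ≡ map h a
      forthτ {y} e = forth (trans (cong st (σ∘τ y)) e)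

      box← : ∀ {y} → st′ y ≡ nothing → st (σ y) ≡ nothing
      box← {y} e = map-nothing⁻¹ h (trans (sym (st′≡ y)) e)

      label← : ∀ {y} → st′ y ≡ just i′ → st (σ y) ≡ just i
      label← {y} e with st (σ y) in e₀ | trans (sym (st′≡ y)) e
      ... | just v | hv≡i′ = cong just (h-injective-at-i e₀ (just-injective hv≡i′))

      above→ : ∀ {x y} → C (σ x) y → C′ x (τ y)
      above→ {x} {y} c = C⇒C′ (subst (C (σ x)) (sym (σ∘τ y)) c)

      below→ : ∀ {x y} → C y (σ x) → C′ (τ y) x
      below→ {x} {y} c = C⇒C′ (subst (λ z → C z (σ x)) (sym (σ∘τ y)) c)

    transportCase : ∀ {x} → SlideCase C i st (σ x) → SlideCase C′ i′ st′ x
    transportCase (fill e (y , c , ey)) =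
      fill (forth e) (τ y , above→ c , trans (forthτ ey) (cong just h-i))
    transportCase (stay-box e ¬p) =
      stay-box (forth e) (λ (y , c , ey) → ¬p (σ y , C′⇒C c , label← ey))
    transportCase (vacate e (y , c , ey)) =
      vacate (trans (forth e) (cong just h-i)) (τ y , below→ c , forthτ ey)
    transportCase (stay-label e ¬p) =
      stay-label (trans (forth e) (cong just h-i)) (λ (y , c , ey) → ¬p (σ y , C′⇒C c , box← ey))
    transportCase (untouched e v≢i) =
      untouched (forth e) (v≢i ∘ h-injective-at-i e)

    after-transportCase : ∀ {x} (c : SlideCase C i st (σ x)) →
                          after C′ i′ st′ x (transportCase c) ≡ map h (after C i st (σ x) c)
    after-transportCase (fill _ _)       = cong just (sym h-i)
    after-transportCase (stay-box _ _)   = refl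
    after-transportCase (vacate _ _)     = refl
    after-transportCase (stay-label _ _) = cong just (sym h-i)
    after-transportCase (untouched _ _)  = refl

    slideStep-transport : (C? : Decidable C) (C′? : Decidable C′) (x : Elt) →
                          slideStep P C′ C′? i′ st′ x ≡ map h (slideStep P C C? i st (σ x))
    slideStep-transport C? C′? x = begin
      slideStep P C′ C′? i′ st′ x                 ≡⟨ slideStep-case C′? i′ st′ x (transportCase c) ⟩
      after C′ i′ st′ x (transportCase c)         ≡⟨ after-transportCase c ⟩
      map h (after C i st (σ x) c)                ≡⟨ cong (map h) (slideStep-case C? i st (σ x) c) ⟨
      map h (slideStep P C C? i st (σ x))         ∎
      where
      open ≡-Reasoning
      c : SlideCase C i st (σ x)
      c = slideCase C? i st (σ x)

  module _ {C : Rel Elt 0ℓ} (C? : Decidable C) {i : ℕ} {st : State P} (Q : ℕ → Set)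
           (Q-i : Q i) (Q-st : ∀ {y v} → st y ≡ just v → Q v) where

    slideStep-labels : ∀ {x v} → slideStep P C C? i st x ≡ just v → Q v
    slideStep-labels {x} e = labels (slideCase C? i st x) (trans (sym (slideStep-case C? i st x _)) e)
      where
      labels : ∀ {v} (c : SlideCase C i st x) → after C i st x c ≡ just v → Q v
      labels (fill _ _)       refl = Q-i
      labels (stay-label _ _) refl = Q-i
      labels (untouched e _)  refl = Q-st e

module Reversal (P : FinPoset) where
  open FinPoset P
  open Sliding P

  Down Up : ℕ → State P → State P
  Down = slideStep P (_⋗_ P) (λ x y → y ⋖? x)
  Up   = slideStep P _⋖_ _⋖?_

  -- A box compares like the half-integer j + ½.
  data _<[_]_ : Maybe ℕ → ℕ → Maybe ℕ → Set where
    label<label : ∀ {a b j} → a < b → just a <[ j ] just b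
    label<box   : ∀ {a j} → a ≤ j → just a <[ j ] nothing
    box<label   : ∀ {b j} → j < b → nothing <[ j ] just b

  DownCase : ℕ → State P → Elt → Set
  DownCase = SlideCase (_⋗_ P)

  downCase : ∀ j s x → DownCase j s x
  downCase = slideCase (λ x y → y ⋖? x)

  Down-case : ∀ {j s x} (c : DownCase j s x) → Down j s x ≡ after _ _ _ _ c
  Down-case = slideStep-case _ _ _ _

  Increasing : ℕ → State P → Set
  Increasing j s = ∀ {x y} → x <ₚ y → s x <[ j ] s y

  module _ {j : ℕ} {s : State P} (inc : Increasing j s) where

    ordered : ∀ {x y a b} → x <ₚ y → s x ≡ a → s y ≡ b → a <[ j ] b
    ordered lt refl refl = inc lt

    label-below-box⇒⋖ : ∀ {x y} → s x ≡ just j → s y ≡ nothing → x <ₚ y → x ⋖ y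
    label-below-box⇒⋖ ex ey lt =
      lt , λ z (x<z , z<y) → nothing-between (ordered x<z ex refl) (ordered z<y refl ey)
      where
      nothing-between : ∀ {a} → just j <[ j ] a → a <[ j ] nothing → ⊥
      nothing-between (label<label j<b) (label<box b≤j) = <⇒≱ j<b b≤j

  module _ {j : ℕ} {s : State P} (inc : Increasing (suc j) s) where

    below-kept-label : ∀ {x y b} → x <ₚ y → s y ≡ just b → (cx : DownCase (suc j) s x) →
                  after _ _ _ _ cx <[ j ] just b
    below-kept-label lt ey (fill ex _) with ordered inc lt ex ey
    ... | box<label J<b = label<label J<b
    below-kept-label lt ey (stay-box ex _) with ordered inc lt ex ey
    ... | box<label J<b = box<label (<⇒≤ J<b)
    below-kept-label lt ey (vacate ex _) with ordered inc lt ex ey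
    ... | label<label J<b = box<label (<⇒≤ J<b)
    below-kept-label lt ey (stay-label ex _) with ordered inc lt ex ey
    ... | label<label J<b = label<label J<b
    below-kept-label lt ey (untouched ex _) with ordered inc lt ex ey
    ... | label<label v<b = label<label v<b

    below-filled : ∀ {x y} → x <ₚ y → s y ≡ nothing → (cx : DownCase (suc j) s x) →
                   after _ _ _ _ cx <[ j ] just (suc j)
    below-filled lt ey (fill ex _) with ordered inc lt ex ey
    ... | ()
    below-filled lt ey (stay-box ex _) with ordered inc lt ex ey
    ... | ()
    below-filled lt ey (vacate _ _) = box<label ≤-refl
    below-filled {y = y} lt ey (stay-label ex ¬vac) =
      ⊥-elim (¬vac (y , label-below-box⇒⋖ inc ex ey lt , ey))
    below-filled lt ey (untouched ex v≢J) with ordered inc lt ex ey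
    ... | label<box v≤J = label<label (≤∧≢⇒< v≤J v≢J)

    below-kept-box : ∀ {x y} → x <ₚ y → s y ≡ nothing → ¬ Fills (_⋗_ P) (suc j) s y →
                  (cx : DownCase (suc j) s x) → after _ _ _ _ cx <[ j ] nothing
    below-kept-box lt ey _ (fill ex _) with ordered inc lt ex ey
    ... | ()
    below-kept-box lt ey _ (stay-box ex _) with ordered inc lt ex ey
    ... | ()
    below-kept-box {x} lt ey ¬fill (vacate ex _) =
      ⊥-elim (¬fill (x , label-below-box⇒⋖ inc ex ey lt , ex))
    below-kept-box {x} lt ey ¬fill (stay-label ex _) =
      ⊥-elim (¬fill (x , label-below-box⇒⋖ inc ex ey lt , ex))
    below-kept-box lt ey _ (untouched ex v≢J) with ordered inc lt ex ey
    ... | label<box v≤J = label<box (≤-pred (≤∧≢⇒< v≤J v≢J))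

    below-vacated : ∀ {x y} → x <ₚ y → s y ≡ just (suc j) → (cx : DownCase (suc j) s x) →
                    after _ _ _ _ cx <[ j ] nothing
    below-vacated lt ey (fill ex _) with ordered inc lt ex ey
    ... | box<label J<J = ⊥-elim (<-irrefl refl J<J)
    below-vacated lt ey (stay-box ex _) with ordered inc lt ex ey
    ... | box<label J<J = ⊥-elim (<-irrefl refl J<J)
    below-vacated lt ey (vacate ex _) with ordered inc lt ex ey
    ... | label<label J<J = ⊥-elim (<-irrefl refl J<J)
    below-vacated lt ey (stay-label ex _) with ordered inc lt ex ey
    ... | label<label J<J = ⊥-elim (<-irrefl refl J<J)
    below-vacated lt ey (untouched ex _) with ordered inc lt ex ey
    ... | label<label v<J = label<box (≤-pred v<J)

    Down-increasing : Increasing j (Down (suc j) s)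
    Down-increasing {x} {y} lt =
      subst₂ _<[ j ]_ (sym (Down-case cx)) (sym (Down-case cy)) (by-cases cy)
      where
      cx : DownCase (suc j) s x
      cx = downCase (suc j) s x
      cy : DownCase (suc j) s y
      cy = downCase (suc j) s y
      by-cases : (cy : DownCase (suc j) s y) → after _ _ _ _ cx <[ j ] after _ _ _ _ cy
      by-cases (fill ey _)         = below-filled lt ey cx
      by-cases (stay-box ey ¬fill) = below-kept-box lt ey ¬fill cx
      by-cases (vacate ey _)       = below-vacated lt ey cx
      by-cases (stay-label ey _)   = below-kept-label lt ey cx
      by-cases (untouched ey _)    = below-kept-label lt ey cx

  module _ {j : ℕ} {s : State P} (inc : Increasing j s) where

    private
      d : State P
      d = Down j s

    no-label-above-box : ∀ {x w} → s x ≡ nothing → x <ₚ w → d w ≢ just j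
    no-label-above-box {x} {w} ex lt dw = impossible (downCase j s w) (trans (sym (Down-case _)) dw)
      where
      impossible : (cw : DownCase j s w) → after _ _ _ _ cw ≢ just j
      impossible (fill ew _) _ with ordered inc lt ex ew
      ... | ()
      impossible (stay-label ew _) _ with ordered inc lt ex ew
      ... | box<label j<j = <-irrefl refl j<j
      impossible (untouched _ v≢j) e = v≢j (just-injective e)

    no-box-below-kept-label : ∀ {x w} → s x ≡ just j → w <ₚ x → d w ≢ nothing
    no-box-below-kept-label {x} {w} ex lt dw = impossible (downCase j s w) (trans (sym (Down-case _)) dw)
      where
      impossible : (cw : DownCase j s w) → after _ _ _ _ cw ≢ nothing
      impossible (stay-box ew _) _ with ordered inc lt ew ex
      ... | box<label j<j = <-irrefl refl j<j
      impossible (vacate ew _) _ with ordered inc lt ew ex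
      ... | label<label j<j = <-irrefl refl j<j

    undo : ∀ {x} → DownCase j s x → SlideCase _⋖_ j d x
    undo {x} c@(fill ex (w , w⋖x , ew)) =
      vacate (Down-case c) (w , w⋖x , Down-case (vacate ew (x , w⋖x , ex)))
    undo c@(stay-box ex _) =
      stay-box (Down-case c) (λ (w , x⋖w , dw) → no-label-above-box ex (proj₁ x⋖w) dw)
    undo {x} c@(vacate ex (w , x⋖w , ew)) =
      fill (Down-case c) (w , x⋖w , Down-case (fill ew (x , x⋖w , ex)))
    undo c@(stay-label ex _) =
      stay-label (Down-case c) (λ (w , w⋖x , dw) → no-box-below-kept-label ex (proj₁ w⋖x) dw)
    undo c@(untouched _ v≢j) = untouched (Down-case c) v≢j

    after-undo : ∀ {x} (c : DownCase j s x) → after _ _ _ _ (undo c) ≡ s x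
    after-undo (fill ex _)       = sym ex
    after-undo (stay-box ex _)   = sym ex
    after-undo (vacate ex _)     = sym ex
    after-undo (stay-label ex _) = sym ex
    after-undo (untouched ex _)  = sym ex

    Up-Down : ∀ x → Up j (Down j s) x ≡ s x
    Up-Down x = trans (slideStep-case _⋖?_ j d x (undo c)) (after-undo c)
      where
      c : DownCase j s x
      c = downCase j s x

-- The initial state of Pro (c = 1) and of Pro⁻¹ (c = q) at an element labelled a.
boxAt : ℕ → ℕ → Maybe ℕ
boxAt c a = if does (a ℕ.≟ c) then nothing else just a

data BoxAtView (c a : ℕ) : Maybe ℕ → Set where
  box   : a ≡ c → BoxAtView c a nothing
  label : a ≢ c → BoxAtView c a (just a)

boxAt-view : ∀ c a → BoxAtView c a (boxAt c a)
boxAt-view c a = view (a ℕ.≟ c)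
  where
  view : (d : Dec (a ≡ c)) → BoxAtView c a (if does d then nothing else just a)
  view (yes a≡c) = box a≡c
  view (no a≢c)  = label a≢c

module Duality {P : FinPoset} (sd : SelfDual P) where
  open FinPoset P
  open SelfDual sd

  κ-injective : ∀ {a b} → κ a ≡ κ b → a ≡ b
  κ-injective {a} {b} e = trans (sym (κ-involutive a)) (trans (cong κ e) (κ-involutive b))

  κ-< : ∀ {a b} → a <ₚ b → κ b <ₚ κ a
  κ-< (a≤b , a≢b) = κ-reversing a≤b , λ e → a≢b (sym (κ-injective e))

  κ-⋖ : ∀ {a b} → a ⋖ b → κ b ⋖ κ a
  κ-⋖ {a} {b} (a<b , nothing-between) = κ-< a<b , λ z (κb<z , z<κa) →
    nothing-between (κ z) ( subst (_<ₚ κ z) (κ-involutive a) (κ-< z<κa)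
                          , subst (κ z <ₚ_) (κ-involutive b) (κ-< κb<z))

  κ-⋖⁻¹ : ∀ {a b} → κ b ⋖ κ a → a ⋖ b
  κ-⋖⁻¹ {a} {b} c = subst₂ _⋖_ (κ-involutive a) (κ-involutive b) (κ-⋖ c)

-- q = suc n; for q = 0 there is no increasing labeling of a nonempty poset.
module Promotion (P : FinPoset) (sd : SelfDual P) (n : ℕ) (f : Labeling P)
                 (inc : IsInc P (suc n) f) where
  open FinPoset P
  open SelfDual sd
  open Sliding P
  open Reversal P
  open Duality sd

  invState : ℕ → State P
  invState = proInvState P (suc n) f

  invState-suc : ∀ {m j} → m + suc j ≡ n → invState (suc m) ≡ Down (suc j) (invState m)
  invState-suc {m} {j} e = cong (λ l → Down l (invState m)) n∸m≡1+j
    where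
    n∸m≡1+j : n ∸ m ≡ suc j
    n∸m≡1+j = trans (cong (_∸ m) (sym e)) (m+n∸m≡n m (suc j))

  invState-labels : ∀ {k} → k ≤ n → ∀ {x v} → invState k x ≡ just v → 1 ≤ v × v ≤ suc n
  invState-labels {zero} _ {x} = initial-labels (boxAt-view (suc n) (f x))
    where
    initial-labels : ∀ {t v} → BoxAtView (suc n) (f x) t → t ≡ just v → 1 ≤ v × v ≤ suc n
    initial-labels (label _) refl = proj₁ inc x
  invState-labels {suc k} k<n =
    slideStep-labels _ (λ v → 1 ≤ v × v ≤ suc n)
      (m<n⇒0<n∸m k<n , ≤-trans (m∸n≤m n k) (n≤1+n n)) (invState-labels (<⇒≤ k<n))

  invState-increasing : ∀ m j → m + j ≡ n → Increasing j (invState m)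
  invState-increasing zero j refl {x} {y} x<y =
    initial-increasing (boxAt-view (suc j) (f x)) (boxAt-view (suc j) (f y))
    where
    fx<fy : f x < f y
    fx<fy = proj₂ inc x<y
    initial-increasing : ∀ {t u} → BoxAtView (suc j) (f x) t → BoxAtView (suc j) (f y) u → t <[ j ] u
    initial-increasing (box fx≡) (box fy≡) = ⊥-elim (<⇒≢ fx<fy (trans fx≡ (sym fy≡)))
    initial-increasing (box fx≡) (label _) =
      ⊥-elim (<⇒≱ fx<fy (subst (f y ≤_) (sym fx≡) (proj₂ (proj₁ inc y))))
    initial-increasing (label fx≢) (box _) = label<box (≤-pred (≤∧≢⇒< (proj₂ (proj₁ inc x)) fx≢))
    initial-increasing (label _) (label _) = label<label fx<fy
  invState-increasing (suc m) j e =
    subst (Increasing j) (sym (invState-suc e′)) (Down-increasing (invState-increasing m (suc j) e′))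
    where
    e′ : m + suc j ≡ n
    e′ = trans (+-suc m j) e

  complement : ℕ → ℕ
  complement v = suc (suc n) ∸ v

  complement-label : ∀ {k} → k ≤ n → complement (n ∸ k) ≡ suc (suc k)
  complement-label {k} k≤n = begin
    (2 + n) ∸ (n ∸ k)   ≡⟨ +-∸-assoc 2 (m∸n≤m n k) ⟩
    2 + (n ∸ (n ∸ k))   ≡⟨ cong (2 +_) (m∸[m∸n]≡n k≤n) ⟩
    2 + k               ∎
    where open ≡-Reasoning

  swap-state : ∀ k → k ≤ n → ∀ x →
               proState P (suc n) (swap sd (suc n) f) k x ≡ map complement (invState k (κ x))
  swap-state zero _ x = initial (boxAt-view 1 (complement a)) (boxAt-view (suc n) a)
    where
    a : ℕ
    a = f (κ x)
    a≤ : a ≤ suc (suc n)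
    a≤ = m≤n⇒m≤1+n (proj₂ (proj₁ inc (κ x)))
    initial : ∀ {t u} → BoxAtView 1 (complement a) t → BoxAtView (suc n) a u → t ≡ map complement u
    initial (box _) (box _) = refl
    initial (box ca≡1) (label a≢) =
      ⊥-elim (a≢ (∸-cancelˡ-≡ a≤ (n≤1+n _) (trans ca≡1 (sym (m+n∸n≡m 1 (suc n))))))
    initial (label ca≢1) (box a≡) = ⊥-elim (ca≢1 (trans (cong complement a≡) (m+n∸n≡m 1 (suc n))))
    initial (label _) (label _) = refl
  swap-state (suc k) k<n x =
    slideStep-transport κ-involutive κ-⋖ κ-⋖⁻¹ (complement-label k≤n) (swap-state k k≤n) h-injective
      (λ x y → y ⋖? x) _⋖?_ x
    where
    k≤n : k ≤ n
    k≤n = <⇒≤ k<n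
    h-injective : ∀ {y v} → invState k y ≡ just v → complement v ≡ suc (suc k) → v ≡ n ∸ k
    h-injective e cv =
      ∸-cancelˡ-≡ (m≤n⇒m≤1+n (proj₂ (invState-labels k≤n e)))
                  (m≤n⇒m≤1+n (m≤n⇒m≤1+n (m∸n≤m n k)))
                  (trans cv (sym (complement-label k≤n)))

  Pro⁻¹-initial : ∀ x → proState P (suc n) (Pro⁻¹ P (suc n) f) 0 x ≡ map suc (invState n x)
  Pro⁻¹-initial x with invState n x in e
  ... | nothing = refl
  ... | just v  = shifted-label (boxAt-view 1 (suc v))
    where
    shifted-label : ∀ {t} → BoxAtView 1 (suc v) t → t ≡ just (suc v)
    shifted-label (box sv≡1) = ⊥-elim (m<n⇒n≢0 (proj₁ (invState-labels ≤-refl e)) (suc-injective sv≡1))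
    shifted-label (label _)  = refl

  Pro⁻¹-state : ∀ k m → m + k ≡ n → ∀ x →
                proState P (suc n) (Pro⁻¹ P (suc n) f) k x ≡ map suc (invState m x)
  Pro⁻¹-state zero m e x with trans (sym (+-identityʳ m)) e
  ... | refl = Pro⁻¹-initial x
  Pro⁻¹-state (suc k) m e x = begin
    Up (suc (suc k)) (proState P (suc n) (Pro⁻¹ P (suc n) f) k) x
      ≡⟨ slideStep-transport (λ _ → refl) id id refl {st = Down (suc k) (invState m)} previous
                             (λ _ → suc-injective) _⋖?_ _⋖?_ x ⟩
    map suc (Up (suc k) (Down (suc k) (invState m)) x)
      ≡⟨ cong (map suc) (Up-Down (invState-increasing m (suc k) e) x) ⟩
    map suc (invState m x) ∎
    where
    open ≡-Reasoning
    previous : ∀ y → proState P (suc n) (Pro⁻¹ P (suc n) f) k y ≡ map suc (Down (suc k) (invState m) y)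
    previous y = trans (Pro⁻¹-state k (suc m) (trans (sym (+-suc m k)) e) y)
                       (cong (λ s → map suc (s y)) (invState-suc e))

  BoxedInPro⁻¹ : Pred Elt 0ℓ
  BoxedInPro⁻¹ x = ∃[ k ] (k ≤ n × invState k x ≡ nothing)

  S-swap≐ : S P (suc n) (swap sd (suc n) f) ≐ (BoxedInPro⁻¹ ∘ κ)
  S-swap≐ = (λ {x} (k , k≤n , e) →
                k , k≤n , map-nothing⁻¹ complement (trans (sym (swap-state k k≤n x)) e))
          , (λ {x} (k , k≤n , e) → k , k≤n , trans (swap-state k k≤n x) (map-nothing e))

  S-Pro⁻¹≐ : S P (suc n) (Pro⁻¹ P (suc n) f) ≐ BoxedInPro⁻¹
  S-Pro⁻¹≐ = (λ {x} (k , k≤n , e) → n ∸ k , m∸n≤m n k ,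
                 map-nothing⁻¹ suc (trans (sym (Pro⁻¹-state k (n ∸ k) (m∸n+n≡m k≤n) x)) e))
           , (λ {x} (m , m≤n , e) → n ∸ m , m∸n≤m n m ,
                 trans (Pro⁻¹-state (n ∸ m) m (m+[n∸m]≡n m≤n) x) (map-nothing e))

lemma5p7 : (P : FinPoset) (sd : SelfDual P) (q : ℕ) (f : Labeling P) →
    IsInc P q f →
    S P q (swap sd q f) ≐ image (SelfDual.κ sd) (S⁻¹ P q f)
lemma5p7 P sd zero f (bounded , _) = (λ {x} _ → empty x) , (λ {x} _ → empty x)
  where
  empty : ∀ {A : Set} x → A
  empty x = ⊥-elim (<⇒≱ (proj₁ (bounded x)) (proj₂ (bounded x)))
lemma5p7 P sd (suc n) f inc =
    (λ {x} Sx → κ x , proj₂ S-Pro⁻¹≐ (proj₁ S-swap≐ Sx) , κ-involutive x)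
  , (λ { (a , S⁻¹a , refl) →
          proj₂ S-swap≐ (subst BoxedInPro⁻¹ (sym (κ-involutive a)) (proj₁ S-Pro⁻¹≐ S⁻¹a)) })
  where
  open SelfDual sd
  open Promotion P sd n f inc
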